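{- There is an absolute constant $d>0$ such that for every $k\in\mathbb{N}$ and $0<\varepsilon<1/2$ there is a set $\mathrm{CP}(k,\varepsilon)\subseteq\{0,1,\dots,k\}$ containing $k$ and satisfying: (1) $\sum_{i\in\mathrm{CP}(k,\varepsilon)}(k-i)\le d\cdot\frac k\varepsilon$; and (2) for all $i\in\{0,1,\dots,k\}$, $\sum_{i'=i+1}^{s(i)}\frac1{k-(i'-1)}\le\varepsilon$, where $s(i)=\min\{i'\in\mathrm{CP}(k,\varepsilon):i'\ge i\}$.
   Formalization: The parameter ε ranges over the rationals, and the absolute constant d is taken in the rationals. -}

module Defs where

open import Data.Bool using (Bool; true; false; if_then_else_)
open import Data.Nat using (ℕ; zero; suc; _∸_)
open import Data.List using (map; upTo)
open import Data.Nat.ListAction using (sum)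
open import Data.Integer using (+_)
open import Data.Rational using (ℚ; 0ℚ; _+_; _/_)

-- A subset of ℕ is represented by its (decidable) indicator S : ℕ → Bool.

cpWeight : ℕ → (ℕ → Bool) → ℕ
cpWeight k S = sum (map (λ i → if S i then k ∸ i else 0) (upTo (suc k)))

sumℚ : ℕ → ℕ → (ℕ → ℚ) → ℚ
sumℚ a zero    f = 0ℚ
sumℚ a (suc n) f = f a + sumℚ (suc a) n f

-- the term 1 / (k - (i' - 1)), written as 1 / (1 + (k ∸ i')), which agrees
-- with k - (i' - 1) for 1 ≤ i' ≤ k (the only range in which it is used)
hterm : ℕ → ℕ → ℚ
hterm k i' = (+ 1) / suc (k ∸ i')

hsum : ℕ → ℕ → ℕ → ℚ
hsum k i j = sumℚ (suc i) (j ∸ i) (hterm k)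

-- Measure a checkpoint i by its distance k ∸ i from k and put the checkpoints at the
-- distances 0 = a₀ < a₁ < ⋯ with a_{t+1} = a_t + 1 + ⌊a_t / N⌋, where N = 1 + ⌊Q / P⌋
-- for ε = P / Q, so that 1 / N ≤ ε.  If s is the first checkpoint at or above i and
-- a = k ∸ s, then s ∸ i ≤ ⌊a / N⌋, since otherwise the checkpoint at distance a_{t+1}
-- would lie in [i, s); so the s ∸ i harmonic terms, each at most 1 / (a + 1), add up to
-- at most 1 / N ≤ ε.  For the weight, a_t ≤ N (a_{t+1} − a_t), so by telescoping the
-- distances up to a_T add up to at most (N + 1) a_T; hence the weight is at most
-- (N + 1) k, which is at most 2 k / ε because 2 P ≤ Q.
module Submission where

open import Data.Bool using (Bool; true; false; if_then_else_)
open import Data.Product using (Σ; _×_; _,_; ∃; proj₁; map₁)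
open import Function using (_∘_; mk⇔)
open import Relation.Nullary using (Dec; yes; no; does; ¬_; _×-dec_)
open import Relation.Binary.PropositionalEquality
open import Defs

dec-true⁻¹ : ∀ {A : Set} (a? : Dec A) → does a? ≡ true → A
dec-true⁻¹ (yes a) _ = a

dec-false⁻¹ : ∀ {A : Set} (a? : Dec A) → does a? ≡ false → ¬ A
dec-false⁻¹ (no ¬a) _ = ¬a

module _ where
  open import Data.Nat
    using ( ℕ; zero; suc; _+_; _*_; _∸_; _/_; _%_; _≤_; _<_; _≤′_; ≤′-refl; ≤′-step
          ; z≤n; s≤s; s≤s⁻¹; z<s; NonZero)
  open import Data.Nat.Properties
  open import Data.Nat.DivMod using (m≡m%n+[m/n]*n; m%n<n; m/n*n≤m)
  open import Data.Nat.ListAction using (sum)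
  open import Data.List using (map; upTo; applyUpTo)
  open import Data.List.Properties using (map-applyUpTo; map-upTo; map-cong)
  open import Relation.Nullary.Decidable using (dec-true; dec-false; does-⇔) renaming (map to mapDec)
  open import Relation.Unary using (Decidable)

  private variable
    i k s t u x P Q : ℕ

  m<[1+m/n]*n : ∀ m n .{{_ : NonZero n}} → m < suc (m / n) * n
  m<[1+m/n]*n m n = begin-strict
    m                 ≡⟨ m≡m%n+[m/n]*n m n ⟩
    m % n + m / n * n <⟨ +-monoˡ-< (m / n * n) (m%n<n m n) ⟩
    suc (m / n) * n   ∎
    where open ≤-Reasoning

  [2+m/n]*n≤2*m : ∀ m n .{{_ : NonZero n}} → 2 * n ≤ m → (2 + m / n) * n ≤ 2 * m
  [2+m/n]*n≤2*m m n 2n≤m = begin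
    (2 + m / n) * n   ≡⟨ *-distribʳ-+ n 2 (m / n) ⟩
    2 * n + m / n * n ≤⟨ +-mono-≤ 2n≤m (m/n*n≤m m n) ⟩
    m + m             ≡⟨ cong (m +_) (+-identityʳ m) ⟨
    2 * m             ∎
    where open ≤-Reasoning

  m∸[n∸o]≡m∸n+o : ∀ {m n o} → o ≤ n → n ≤ m → m ∸ (n ∸ o) ≡ m ∸ n + o
  m∸[n∸o]≡m∸n+o {m} {n} {o} o≤n n≤m = begin
    m ∸ (n ∸ o)                      ≡⟨ cong (_∸ (n ∸ o)) m≡ ⟩
    (m ∸ n + o) + (n ∸ o) ∸ (n ∸ o)  ≡⟨ m+n∸n≡m (m ∸ n + o) (n ∸ o) ⟩
    m ∸ n + o                        ∎
    where
    open ≡-Reasoning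
    m≡ : m ≡ (m ∸ n + o) + (n ∸ o)
    m≡ = begin
      m                      ≡⟨ m∸n+n≡m n≤m ⟨
      m ∸ n + n              ≡⟨ cong (m ∸ n +_) (m+[n∸m]≡n o≤n) ⟨
      m ∸ n + (o + (n ∸ o))  ≡⟨ +-assoc (m ∸ n) o (n ∸ o) ⟨
      (m ∸ n + o) + (n ∸ o)  ∎

  cpWeight-suc : ∀ k (S S′ : ℕ → Bool) → (∀ i → S (suc i) ≡ S′ i) →
                 cpWeight (suc k) S ≡ (if S 0 then suc k else 0) + cpWeight k S′
  cpWeight-suc k S S′ S∘suc≗S′ = cong (term 0 +_) (begin
    sum (map term (applyUpTo suc (suc k)))  ≡⟨ cong sum (map-applyUpTo suc term (suc k)) ⟩
    sum (applyUpTo (term ∘ suc) (suc k))    ≡⟨ cong sum (map-upTo (term ∘ suc) (suc k)) ⟨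
    sum (map (term ∘ suc) (upTo (suc k)))   ≡⟨ cong sum (map-cong term∘suc≗ (upTo (suc k))) ⟩
    cpWeight k S′                           ∎)
    where
    open ≡-Reasoning
    term : ℕ → ℕ
    term i = if S i then suc k ∸ i else 0
    term∘suc≗ : ∀ i → term (suc i) ≡ (if S′ i then k ∸ i else 0)
    term∘suc≗ i = cong (λ b → if b then k ∸ i else 0) (S∘suc≗S′ i)

  module Checkpoints (N : ℕ) .{{_ : NonZero N}} where

    next : ℕ → ℕ
    next a = suc (a + a / N)

    point : ℕ → ℕ
    point zero    = zero
    point (suc t) = next (point t)

    point-<-suc : ∀ t → point t < point (suc t)
    point-<-suc t = s≤s (m≤m+n (point t) (point t / N))

    point-mono-≤′ : t ≤′ u → point t ≤ point u
    point-mono-≤′ ≤′-refl            = ≤-refl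
    point-mono-≤′ (≤′-step {u} t≤′u) = ≤-trans (point-mono-≤′ t≤′u) (<⇒≤ (point-<-suc u))

    point-mono-≤ : t ≤ u → point t ≤ point u
    point-mono-≤ = point-mono-≤′ ∘ ≤⇒≤′

    n≤point : ∀ t → t ≤ point t
    n≤point zero    = z≤n
    n≤point (suc t) = ≤-<-trans (n≤point t) (point-<-suc t)

    point-bracket : ∀ x → ∃ λ t → point t ≤ x × x < point (suc t)
    point-bracket zero = 0 , z≤n , point-<-suc 0
    point-bracket (suc x) with point-bracket x
    ... | t , pt≤x , x<pt+1 with suc x <? point (suc t)
    ...   | yes sx<pt+1 = t , m≤n⇒m≤1+n pt≤x , sx<pt+1
    ...   | no  sx≮pt+1 = suc t , ≮⇒≥ sx≮pt+1 , ≤-<-trans x<pt+1 (point-<-suc (suc t))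

    next-growth : ∀ a → suc N * a ≤ N * next a
    next-growth a = begin
      suc N * a                ≡⟨ +-comm a (N * a) ⟩
      N * a + a                ≤⟨ +-monoʳ-≤ (N * a) (<⇒≤ (m<[1+m/n]*n a N)) ⟩
      N * a + suc (a / N) * N  ≡⟨ cong (N * a +_) (*-comm (suc (a / N)) N) ⟩
      N * a + N * suc (a / N)  ≡⟨ *-distribˡ-+ N a (suc (a / N)) ⟨
      N * (a + suc (a / N))    ≡⟨ cong (N *_) (+-suc a (a / N)) ⟩
      N * next a               ∎
      where open ≤-Reasoning

    IsPoint : ℕ → Set
    IsPoint m = ∃ λ t → point t ≡ m

    isPoint? : Decidable IsPoint
    isPoint? m = mapDec (mk⇔ (λ (t , _ , pt≡m) → t , pt≡m) bounded)
                        (anyUpTo? (λ t → point t ≟ m) (suc m))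
      where
      bounded : IsPoint m → ∃ λ t → t < suc m × point t ≡ m
      bounded (t , pt≡m) = t , s≤s (subst (t ≤_) pt≡m (n≤point t)) , pt≡m

    no-point-between : point t < x → x < point (suc t) → ¬ IsPoint x
    no-point-between {t} pt<pu pu<pt+1 (u , refl) with u ≤? t
    ... | yes u≤t = <⇒≱ pt<pu (point-mono-≤ u≤t)
    ... | no  u≰t = <⇒≱ pu<pt+1 (point-mono-≤ (≰⇒> u≰t))

    IsCheckpoint : ℕ → ℕ → Set
    IsCheckpoint k i = i ≤ k × IsPoint (k ∸ i)

    isCheckpoint? : ∀ k i → Dec (IsCheckpoint k i)
    isCheckpoint? k i = i ≤? k ×-dec isPoint? (k ∸ i)

    CP : ℕ → ℕ → Bool
    CP k i = does (isCheckpoint? k i)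

    CP⇒≤ : CP k i ≡ true → i ≤ k
    CP⇒≤ {k} {i} = proj₁ ∘ dec-true⁻¹ (isCheckpoint? k i)

    CP-refl : ∀ k → CP k k ≡ true
    CP-refl k = dec-true (isCheckpoint? k k) (≤-refl , 0 , sym (n∸n≡0 k))

    CP-suc : ∀ k i → CP (suc k) (suc i) ≡ CP k i
    CP-suc k i =
      does-⇔ (mk⇔ (map₁ s≤s⁻¹) (map₁ s≤s)) (isCheckpoint? (suc k) (suc i)) (isCheckpoint? k i)

    NextCheckpoint : ℕ → ℕ → ℕ → Set
    NextCheckpoint k i s = i ≤ s × CP k s ≡ true × (∀ i′ → i ≤ i′ → i′ < s → CP k i′ ≡ false)

    IsCheckpoint-next : IsCheckpoint k s → suc ((k ∸ s) / N) ≤ s →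
                        IsCheckpoint k (s ∸ suc ((k ∸ s) / N))
    IsCheckpoint-next {k} {s} (s≤k , t , pt≡a) g≤s = ≤-trans (m∸n≤m s g) s≤k , suc t , pt+1≡
      where
      a g : ℕ
      a = k ∸ s
      g = suc (a / N)
      pt+1≡ : point (suc t) ≡ k ∸ (s ∸ g)
      pt+1≡ = begin
        next (point t)  ≡⟨ cong next pt≡a ⟩
        next a          ≡⟨ +-suc a (a / N) ⟨
        a + g           ≡⟨ m∸[n∸o]≡m∸n+o g≤s s≤k ⟨
        k ∸ (s ∸ g)     ∎
        where open ≡-Reasoning

    NextCheckpoint-gap : NextCheckpoint k i s → s ∸ i ≤ (k ∸ s) / N
    NextCheckpoint-gap {k} {i} {s} (i≤s , CPs , none) = ≮⇒≥ gap≰s∸i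
      where
      g : ℕ
      g = suc ((k ∸ s) / N)
      gap≰s∸i : ¬ (g ≤ s ∸ i)
      gap≰s∸i g≤s∸i = dec-false⁻¹ (isCheckpoint? k (s ∸ g)) (none (s ∸ g) i≤s∸g s∸g<s)
                        (IsCheckpoint-next (dec-true⁻¹ (isCheckpoint? k s) CPs) g≤s)
        where
        g≤s : g ≤ s
        g≤s = ≤-trans g≤s∸i (m∸n≤m s i)
        i≤s∸g : i ≤ s ∸ g
        i≤s∸g = subst (_≤ s ∸ g) (m∸[m∸n]≡n i≤s) (∸-monoʳ-≤ s g≤s∸i)
        s∸g<s : s ∸ g < s
        s∸g<s = ∸-monoʳ-< {o = 0} z<s g≤s

    NextCheckpoint-gap-ratio : Q ≤ N * P → NextCheckpoint k i s → (s ∸ i) * Q ≤ P * suc (k ∸ s)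
    NextCheckpoint-gap-ratio {Q} {P} {k} {i} {s} Q≤NP next-s = begin
      (s ∸ i) * Q        ≤⟨ *-monoʳ-≤ (s ∸ i) Q≤NP ⟩
      (s ∸ i) * (N * P)  ≡⟨ *-assoc (s ∸ i) N P ⟨
      (s ∸ i) * N * P    ≤⟨ *-monoˡ-≤ P [s∸i]*N≤k∸s ⟩
      (k ∸ s) * P        ≤⟨ *-monoˡ-≤ P (n≤1+n (k ∸ s)) ⟩
      suc (k ∸ s) * P    ≡⟨ *-comm (suc (k ∸ s)) P ⟩
      P * suc (k ∸ s)    ∎
      where
      open ≤-Reasoning
      [s∸i]*N≤k∸s : (s ∸ i) * N ≤ k ∸ s
      [s∸i]*N≤k∸s = ≤-trans (*-monoˡ-≤ N (NextCheckpoint-gap next-s)) (m/n*n≤m (k ∸ s) N)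

    weight : ℕ → ℕ
    weight k = cpWeight k (CP k)

    weight-suc : ∀ x → weight (suc x) ≡ (if does (isPoint? (suc x)) then suc x else 0) + weight x
    weight-suc x = cpWeight-suc x (CP (suc x)) (CP x) (CP-suc x)

    weight-suc-point : IsPoint (suc x) → weight (suc x) ≡ suc x + weight x
    weight-suc-point {x} p = trans (weight-suc x)
      (cong (λ b → (if b then suc x else 0) + weight x) (dec-true (isPoint? (suc x)) p))

    weight-suc-nonpoint : ¬ IsPoint (suc x) → weight (suc x) ≡ weight x
    weight-suc-nonpoint {x} ¬p = trans (weight-suc x)
      (cong (λ b → (if b then suc x else 0) + weight x) (dec-false (isPoint? (suc x)) ¬p))

    weight-between : point t ≤′ x → x < point (suc t) → weight x ≡ weight (point t)
    weight-between ≤′-refl _ = refl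
    weight-between {t} (≤′-step {x} pt≤′x) sx<pt+1 = begin
      weight (suc x)   ≡⟨ weight-suc-nonpoint (no-point-between (s≤s (≤′⇒≤ pt≤′x)) sx<pt+1) ⟩
      weight x         ≡⟨ weight-between pt≤′x (<⇒≤ sx<pt+1) ⟩
      weight (point t) ∎
      where open ≡-Reasoning

    weight-point : ∀ t → weight (point t) ≤ suc N * point t
    weight-point zero    = z≤n
    weight-point (suc t) = begin
      weight (next a)              ≡⟨ weight-suc-point (suc t , refl) ⟩
      next a + weight (a + a / N)  ≡⟨ cong (next a +_) (weight-between a≤′a+a/N ≤-refl) ⟩
      next a + weight a            ≤⟨ +-monoʳ-≤ (next a) (weight-point t) ⟩
      next a + suc N * a           ≤⟨ +-monoʳ-≤ (next a) (next-growth a) ⟩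
      suc N * next a               ∎
      where
      open ≤-Reasoning
      a : ℕ
      a = point t
      a≤′a+a/N : a ≤′ a + a / N
      a≤′a+a/N = ≤⇒≤′ (m≤m+n a (a / N))

    weight-≤ : ∀ k → weight k ≤ suc N * k
    weight-≤ k with point-bracket k
    ... | t , pt≤k , k<pt+1 = begin
      weight k         ≡⟨ weight-between (≤⇒≤′ pt≤k) k<pt+1 ⟩
      weight (point t) ≤⟨ weight-point t ⟩
      suc N * point t  ≤⟨ *-monoʳ-≤ (suc N) pt≤k ⟩
      suc N * k        ∎
      where open ≤-Reasoning

    weight-ratio : suc N * P ≤ 2 * Q → ∀ k → weight k * P ≤ 2 * k * Q
    weight-ratio {P} {Q} [1+N]P≤2Q k = begin
      weight k * P       ≤⟨ *-monoˡ-≤ P (weight-≤ k) ⟩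
      suc N * k * P      ≡⟨ cong (_* P) (*-comm (suc N) k) ⟩
      k * suc N * P      ≡⟨ *-assoc k (suc N) P ⟩
      k * (suc N * P)    ≤⟨ *-monoʳ-≤ k [1+N]P≤2Q ⟩
      k * (2 * Q)        ≡⟨ *-assoc k 2 Q ⟨
      k * 2 * Q          ≡⟨ cong (_* Q) (*-comm k 2) ⟩
      2 * k * Q          ∎
      where open ≤-Reasoning

module _ where
  open import Data.Nat as ℕ using (ℕ; zero; suc; z≤n; s≤s; s≤s⁻¹; _∸_)
  import Data.Nat.Properties as ℕ
  open import Data.Nat.Coprimality using (Coprime)
  open import Data.Integer as ℤ using (+_; +≤+)
  import Data.Integer.Properties as ℤ
  open import Data.Rational using (ℚ; mkℚ; _+_; _*_; _/_; _÷_; 1/_; _≤_; _<_; *<*; toℚᵘ)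
  open import Data.Rational.Properties
    using ( toℚᵘ-cancel-≤; toℚᵘ-fromℚᵘ; toℚᵘ-injective; toℚᵘ-homo-+; toℚᵘ-homo-*
          ; +-mono-≤; /-cong; ↥p/↧p≡p; module ≤-Reasoning)
  open import Data.Rational.Unnormalised as ℚᵘ using (mkℚᵘ; *≤*; _≃_)
  import Data.Rational.Unnormalised.Properties as ℚᵘ

  toℚᵘ-/ : ∀ a m → toℚᵘ (+ a / suc m) ≃ mkℚᵘ (+ a) m
  toℚᵘ-/ a m = toℚᵘ-fromℚᵘ (mkℚᵘ (+ a) m)

  +/-mono-≤ : ∀ a m b n → a ℕ.* suc n ℕ.≤ b ℕ.* suc m → + a / suc m ≤ + b / suc n
  +/-mono-≤ a m b n a*n≤b*m = toℚᵘ-cancel-≤ (begin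
    toℚᵘ (+ a / suc m)  ≃⟨ toℚᵘ-/ a m ⟩
    mkℚᵘ (+ a) m        ≤⟨ *≤* (subst₂ ℤ._≤_ (ℤ.pos-* a (suc n)) (ℤ.pos-* b (suc m)) (+≤+ a*n≤b*m)) ⟩
    mkℚᵘ (+ b) n        ≃⟨ toℚᵘ-/ b n ⟨
    toℚᵘ (+ b / suc n)  ∎)
    where open ℚᵘ.≤-Reasoning

  +/-+ : ∀ a b m → + a / suc m + + b / suc m ≡ + (a ℕ.+ b) / suc m
  +/-+ a b m = toℚᵘ-injective (begin
    toℚᵘ (+ a / suc m + + b / suc m)
      ≈⟨ toℚᵘ-homo-+ (+ a / suc m) (+ b / suc m) ⟩
    toℚᵘ (+ a / suc m) ℚᵘ.+ toℚᵘ (+ b / suc m)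
      ≈⟨ ℚᵘ.+-cong (toℚᵘ-/ a m) (toℚᵘ-/ b m) ⟩
    mkℚᵘ (+ a) m ℚᵘ.+ mkℚᵘ (+ b) m
      ≡⟨ ℚᵘ./-cong (sym (ℤ.*-distribʳ-+ (+ suc m) (+ a) (+ b))) refl ⟩
    (+ (a ℕ.+ b) ℤ.* + suc m) ℚᵘ./ (suc m ℕ.* suc m)
      ≈⟨ ℚᵘ.*-cancelʳ-/ (suc m) ⟩
    mkℚᵘ (+ (a ℕ.+ b)) m
      ≈⟨ toℚᵘ-/ (a ℕ.+ b) m ⟨
    toℚᵘ (+ (a ℕ.+ b) / suc m)
      ∎)
    where open ℚᵘ.≃-Reasoning

  +/-* : ∀ a m b n → (+ a / suc m) * (+ b / suc n) ≡ + (a ℕ.* b) / (suc m ℕ.* suc n)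
  +/-* a m b n = toℚᵘ-injective (begin
    toℚᵘ ((+ a / suc m) * (+ b / suc n))
      ≈⟨ toℚᵘ-homo-* (+ a / suc m) (+ b / suc n) ⟩
    toℚᵘ (+ a / suc m) ℚᵘ.* toℚᵘ (+ b / suc n)
      ≈⟨ ℚᵘ.*-cong (toℚᵘ-/ a m) (toℚᵘ-/ b n) ⟩
    mkℚᵘ (+ a) m ℚᵘ.* mkℚᵘ (+ b) n
      ≡⟨ ℚᵘ./-cong (sym (ℤ.pos-* a b)) refl ⟩
    + (a ℕ.* b) ℚᵘ./ (suc m ℕ.* suc n)
      ≈⟨ toℚᵘ-/ (a ℕ.* b) (n ℕ.+ m ℕ.* suc n) ⟨
    toℚᵘ (+ (a ℕ.* b) / (suc m ℕ.* suc n))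
      ∎)
    where open ℚᵘ.≃-Reasoning

  sumℚ-≤ : ∀ {f : ℕ → ℚ} {c} a n → (∀ j → a ℕ.≤ j → j ℕ.< a ℕ.+ n → f j ≤ + 1 / suc c) →
           sumℚ a n f ≤ + n / suc c
  sumℚ-≤ {c = c} a zero    _  = +/-mono-≤ 0 0 0 c z≤n
  sumℚ-≤ {f} {c} a (suc n) f≤ = begin
    f a + sumℚ (suc a) n f     ≤⟨ +-mono-≤ (f≤ a ℕ.≤-refl (ℕ.m<m+n a ℕ.z<s)) (sumℚ-≤ (suc a) n f≤′) ⟩
    + 1 / suc c + + n / suc c  ≡⟨ +/-+ 1 n c ⟩
    + suc n / suc c            ∎
    where
    open ≤-Reasoning
    f≤′ : ∀ j → suc a ℕ.≤ j → j ℕ.< suc a ℕ.+ n → f j ≤ + 1 / suc c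
    f≤′ j a<j j<a+1+n = f≤ j (ℕ.<⇒≤ a<j) (subst (j ℕ.<_) (sym (ℕ.+-suc a n)) j<a+1+n)

  hterm-mono-≤ : ∀ k {j s} → j ℕ.≤ s → hterm k j ≤ hterm k s
  hterm-mono-≤ k {j} {s} j≤s =
    +/-mono-≤ 1 (k ∸ j) 1 (k ∸ s) (ℕ.*-monoʳ-≤ 1 (s≤s (ℕ.∸-monoʳ-≤ k j≤s)))

  hsum-≤ : ∀ k {i s} → i ℕ.≤ s → hsum k i s ≤ + (s ∸ i) / suc (k ∸ s)
  hsum-≤ k {i} {s} i≤s = sumℚ-≤ (suc i) (s ∸ i) λ j _ j<1+i+[s∸i] →
    hterm-mono-≤ k (s≤s⁻¹ (subst (j ℕ.<_) (cong suc (ℕ.m+[n∸m]≡n i≤s)) j<1+i+[s∸i]))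

  module CheckpointsFor (p q : ℕ) .(coprime : Coprime (suc p) (suc q)) where

    ε : ℚ
    ε = mkℚ (+ suc p) q coprime

    open Checkpoints (suc (suc q ℕ./ suc p)) public

    hsum≤ε : ∀ {k i s} → NextCheckpoint k i s → hsum k i s ≤ ε
    hsum≤ε {k} {i} {s} next-s@(i≤s , _) = begin
      hsum k i s                 ≤⟨ hsum-≤ k i≤s ⟩
      + (s ∸ i) / suc (k ∸ s)    ≤⟨ +/-mono-≤ (s ∸ i) (k ∸ s) (suc p) q gap-ratio ⟩
      + suc p / suc q            ≡⟨ ↥p/↧p≡p ε ⟩
      ε                          ∎
      where
      open ≤-Reasoning
      gap-ratio : (s ∸ i) ℕ.* suc q ℕ.≤ suc p ℕ.* suc (k ∸ s)
      gap-ratio = NextCheckpoint-gap-ratio (ℕ.<⇒≤ (m<[1+m/n]*n (suc q) (suc p))) next-s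

    ε<½⇒2P≤Q : ε < + 1 / 2 → 2 ℕ.* suc p ℕ.≤ suc q
    ε<½⇒2P≤Q (*<* P*2<1*Q) = ℕ.<⇒≤ (subst₂ ℕ._<_ (ℕ.*-comm (suc p) 2) (ℕ.*-identityˡ (suc q))
      (ℤ.drop‿+<+ (subst₂ ℤ._<_ (sym (ℤ.pos-* (suc p) 2)) (sym (ℤ.pos-* 1 (suc q))) P*2<1*Q)))

    weight≤2k÷ε : ε < + 1 / 2 → ∀ k → + weight k / 1 ≤ (+ 2 / 1 * (+ k / 1)) ÷ ε
    weight≤2k÷ε ε<½ k = begin
      + weight k / 1
        ≤⟨ +/-mono-≤ (weight k) 0 (2 ℕ.* k ℕ.* suc q) p weight-ratio′ ⟩
      + (2 ℕ.* k ℕ.* suc q) / suc p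
        ≡⟨ /-cong {+ (2 ℕ.* k ℕ.* suc q)} refl (ℕ.*-identityˡ (suc p)) ⟨
      + (2 ℕ.* k ℕ.* suc q) / (1 ℕ.* suc p)
        ≡⟨ +/-* (2 ℕ.* k) 0 (suc q) p ⟨
      + (2 ℕ.* k) / 1 * (+ suc q / suc p)
        ≡⟨ cong₂ _*_ (+/-* 2 0 k 0) (sym (↥p/↧p≡p (1/ ε))) ⟨
      (+ 2 / 1 * (+ k / 1)) ÷ ε
        ∎
      where
      open ≤-Reasoning
      weight-ratio′ : weight k ℕ.* suc p ℕ.≤ 2 ℕ.* k ℕ.* suc q ℕ.* 1
      weight-ratio′ = ℕ.≤-trans (weight-ratio ([2+m/n]*n≤2*m (suc q) (suc p) (ε<½⇒2P≤Q ε<½)) k)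
                                (ℕ.≤-reflexive (sym (ℕ.*-identityʳ _)))

open import Data.Nat using (ℕ; _≤_; _<_; z≤n; s≤s; zero; suc)
open import Data.Integer using (+_; -[1+_]; +<+)
open import Data.Rational using (ℚ; 0ℚ; _*_; _/_; _÷_; >-nonZero; mkℚ; *<*) renaming (_≤_ to _≤ℚ_; _<_ to _<ℚ_)

lemmaC5 : Σ ℚ λ d → (0ℚ <ℚ d) ×
  ((k : ℕ) (ε : ℚ) (ε>0 : 0ℚ <ℚ ε) → ε <ℚ ((+ 1) / 2) →
    Σ (ℕ → Bool) λ CP →
      ((i : ℕ) → CP i ≡ true → i ≤ k) ×
      (CP k ≡ true) ×
      ((((+ cpWeight k CP) / 1) ≤ℚ ((d * ((+ k) / 1)) ÷ ε) {{>-nonZero ε>0}})) ×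
      ((i : ℕ) → i ≤ k → (s : ℕ) → i ≤ s → CP s ≡ true →
        ((i' : ℕ) → i ≤ i' → i' < s → CP i' ≡ false) →
        hsum k i s ≤ℚ ε))
lemmaC5 = + 2 / 1 , *<* (+<+ (s≤s z≤n)) , λ where
  k (mkℚ (+ suc p) q coprime) _ ε<½ →
    let open CheckpointsFor p q coprime
    in CP k , (λ _ → CP⇒≤) , CP-refl k , weight≤2k÷ε ε<½ k ,
       λ _ _ _ i≤s CPs none → hsum≤ε (i≤s , CPs , none)
  _ (mkℚ (+ zero) _ _)    (*<* (+<+ ())) _
  _ (mkℚ -[1+ _ ] _ _)    (*<* ())       _
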